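{- Let $n\ge 3$, let $D=d_1,\dots,d_n$ be a tree degree sequence, and let $T$ be a uniformly random tree on the vertex set $\{v_1,\dots,v_n\}$ in which $v_k$ has degree $d_k$ for all $k$. Then for any $i\ne j$, the probability that $v_iv_j$ is an edge of $T$ equals $\dfrac{d_i+d_j-2}{n-2}$.
   Context: A degree sequence $D=d_1,\dots,d_n$ is a tree degree sequence if every $d_i$ is a positive integer and $\sum_i d_i=2n-2$. -}

module Defs where

open import Data.Nat using (ℕ; zero; suc; _+_; _*_; _∸_; _≤_)
open import Data.Bool using (Bool; true; false; if_then_else_)
open import Data.Fin using (Fin; zero; suc; inject₁; fromℕ)
open import Data.Vec using (Vec; lookup; map; sum; tabulate)
open import Data.Product using (Σ; _×_)
open import Relation.Nullary using (¬_)
open import Relation.Binary.PropositionalEquality using (_≡_)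

-- A (potential) graph on vertex set Fin n, given by its adjacency matrix.
-- Adjacency matrices are canonical, so distinct labelled graphs are
-- distinct elements of this type.
Graph : ℕ → Set
Graph n = Vec (Vec Bool n) n

entry : ∀ {n} → Graph n → Fin n → Fin n → Bool
entry G i j = lookup (lookup G i) j

record SimpleGraph {n : ℕ} (G : Graph n) : Set where
  field
    sym     : ∀ i j → entry G i j ≡ entry G j i
    irrefl  : ∀ i → entry G i i ≡ false

Adj : ∀ {n} → Graph n → Fin n → Fin n → Set
Adj G i j = entry G i j ≡ true

deg : ∀ {n} → Graph n → Fin n → ℕ
deg G i = sum (map (λ b → if b then 1 else 0) (lookup G i))

data Walk {n : ℕ} (G : Graph n) : Fin n → Fin n → Set where
  here : ∀ {i} → Walk G i i
  step : ∀ {i j k} → Adj G i j → Walk G j k → Walk G i k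

Connected : ∀ {n} → Graph n → Set
Connected G = ∀ i j → Walk G i j

HasCycle : ∀ {n} → Graph n → Set
HasCycle {n} G =
  Σ ℕ λ k → Σ (Vec (Fin n) (3 + k)) λ vs →
    (∀ a b → lookup vs a ≡ lookup vs b → a ≡ b)
    × (∀ (a : Fin (2 + k)) → Adj G (lookup vs (inject₁ a)) (lookup vs (suc a)))
    × Adj G (lookup vs (fromℕ (2 + k))) (lookup vs zero)

IsTree : ∀ {n} → Graph n → Set
IsTree G = SimpleGraph G × Connected G × ¬ HasCycle G

HasDegrees : ∀ {n} → Graph n → (Fin n → ℕ) → Set
HasDegrees G D = ∀ k → deg G k ≡ D k

TreeDegSeq : (n : ℕ) → (Fin n → ℕ) → Set
TreeDegSeq n D = (∀ k → 1 ≤ D k) × (sum (tabulate D) ≡ 2 * n ∸ 2)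

-- Let N(D) be the number of trees with degree sequence D on the s + 2 vertices of positive
-- degree, so that Σ (d − 1) = s. For s ≥ 1 fix a leaf ℓ: deleting it is a bijection between the
-- trees in which ℓ hangs on k and the trees for D with ℓ removed and d_k lowered by one, and only
-- the k with d_k ≥ 2 contribute. Summing over k gives N(D) · ∏ (d − 1)! = s!. The same recursion
-- applied to the trees containing the edge ij, with ℓ ∉ {i, j}, gives
-- E(D) · ∏ (d − 1)! = (d_i + d_j − 2) · (s − 1)!, where a leaf among i, j is itself the leaf
-- deleted. Dividing, E(D) / N(D) = (d_i + d_j − 2) / s with s = n − 2.

module Submission where

open import Defs
open import Data.Nat using (ℕ; zero; suc; _+_; _*_; _∸_; _≤_; _<_; z≤n; s≤s; pred; _!; >-nonZero)
open import Data.Nat.Properties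
  using ( +-*-semiring; +-0-commutativeMonoid; *-1-commutativeMonoid
        ; +-commutativeSemigroup; *-commutativeSemigroup
        ; +-comm; +-assoc; +-identityʳ; +-suc; *-assoc; *-suc; *-distribˡ-+
        ; suc-injective; suc-pred; +-cancelˡ-≡; +-cancelʳ-≡; *-cancelʳ-≡; +-cancelˡ-<
        ; ≤-refl; ≤-trans; ≤-reflexive; ≤-<-trans; <⇒≱; ≮⇒≥; n≤0⇒n≡0; m≤m+n; m≤n+m; m≢1+n+m
        ; +-monoˡ-≤; +-monoʳ-≤; +-mono-≤; *-mono-≤; pred[n]≤n; suc[m]≤n⇒m≤pred[n]; 1≤n!
        ; _<?_; _≤?_ )
  renaming (_≟_ to _≟ℕ_)
import Data.Bool as Bool
open import Data.Bool using (Bool; true; false; if_then_else_; _∨_; _∧_)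
open import Data.Bool.Properties using (∨-zeroʳ; ∧-zeroʳ; ∨-comm; ∧-comm; ¬-not)
open import Data.Fin as Fin using (Fin; zero; suc; punchIn; fromℕ; toℕ)
open import Data.Fin.Properties using (_≟_; punchInᵢ≢i; toℕ-inject₁)
open import Data.Vec as Vec using (Vec; []; _∷_; lookup)
open import Data.Vec.Properties using (lookup-map; lookup∘tabulate; tabulate∘lookup; tabulate-cong)
open import Data.Vec.Functional using (updateAt)
open import Data.Vec.Functional.Properties using (updateAt-updates; updateAt-minimal)
open import Data.Product using (Σ; _×_; _,_; proj₁; proj₂; ∃)
open import Data.List using (List; []; _∷_; length; map; filter)
open import Data.List.Properties using (length-map)
open import Data.List.Membership.Propositional using (_∈_; _∉_)
open import Data.List.Relation.Unary.Any using (here; there)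
import Data.List.Relation.Unary.All as All
open All using (_∷_)
import Data.List.Relation.Unary.All.Properties as All
open import Data.List.Relation.Unary.AllPairs using ([]; _∷_)
open import Data.List.Relation.Unary.Unique.Propositional using (Unique)
import Data.List.Relation.Unary.Unique.Propositional.Properties as Unique
open import Data.List.Membership.Propositional.Properties using (∈-filter⁺; ∈-filter⁻; ∈-map⁺; ∈-map⁻)
open import Data.Sum using (_⊎_; inj₁; inj₂; [_,_]′)
open import Data.Empty using (⊥-elim)
open import Data.Unit using (⊤; tt)
open import Relation.Nullary using (¬_; yes; no; Dec; does; contradiction)
open import Relation.Nullary.Decidable using (dec-true; dec-false)
open import Relation.Binary.PropositionalEquality
  using (_≡_; _≢_; refl; sym; trans; cong; cong₂; subst; subst₂; module ≡-Reasoning)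
open import Function using (_∘′_)
open import Function.Bundles using (_⇔_; Equivalence)

open import Algebra.Bundles using (CommutativeMonoid)
open import Algebra.Properties.Semiring.Sum +-*-semiring
  using (sum; sum-cong-≗; sum-remove; ∑-distrib-+; *-distribʳ-sum; sum-replicate-zero)
open import Algebra.Properties.CommutativeSemigroup *-commutativeSemigroup using (x∙yz≈y∙xz; xy∙z≈y∙xz)
open import Algebra.Properties.CommutativeSemigroup +-commutativeSemigroup
  using () renaming (interchange to +-interchange)
import Algebra.Properties.CommutativeMonoid.Sum as CommutativeMonoidSum
open CommutativeMonoidSum *-1-commutativeMonoid
  using () renaming (sum to product; sum-cong-≗ to product-cong-≗)

-- Sums over Fin n

sum-lookup : ∀ {n} (v : Vec ℕ n) → Vec.sum v ≡ sum (lookup v)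
sum-lookup []      = refl
sum-lookup (x ∷ v) = cong (x +_) (sum-lookup v)

sum-zero : ∀ {n} (f : Fin n → ℕ) → (∀ x → f x ≡ 0) → sum f ≡ 0
sum-zero {n} f f≡0 = trans (sum-cong-≗ f≡0) (sum-replicate-zero n)

sum-ones : ∀ n → sum {n} (λ _ → 1) ≡ n
sum-ones zero    = refl
sum-ones (suc n) = cong suc (sum-ones n)

term≤sum : ∀ {n} (f : Fin n → ℕ) x → f x ≤ sum f
term≤sum {suc n} f x = ≤-trans (m≤m+n (f x) _) (≤-reflexive (sym (sum-remove {i = x} f)))

sum-zero⁻ : ∀ {n} (f : Fin n → ℕ) → sum f ≡ 0 → ∀ x → f x ≡ 0
sum-zero⁻ f ∑f≡0 x = n≤0⇒n≡0 (subst (f x ≤_) ∑f≡0 (term≤sum f x))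

sum-positive : ∀ {n} (f : Fin n → ℕ) → 1 ≤ sum f → ∃ λ x → 1 ≤ f x
sum-positive {suc n} f 1≤∑f with f zero in eq
... | suc _ = zero , subst (1 ≤_) (sym eq) (s≤s z≤n)
... | zero  with sum-positive (λ x → f (suc x)) 1≤∑f
...   | x , 1≤fx = suc x , 1≤fx

sum-< : ∀ {n} (f g : Fin n → ℕ) → sum f < sum g → ∃ λ x → f x < g x
sum-< {suc n} f g ∑f<∑g with f zero <? g zero
... | yes f0<g0 = zero , f0<g0
... | no  f0≮g0 = let x , fx<gx = sum-< (λ x → f (suc x)) (λ x → g (suc x)) rest<rest in suc x , fx<gx
  where
  rest<rest : sum (λ x → f (suc x)) < sum (λ x → g (suc x))
  rest<rest = +-cancelˡ-< (g zero) _ _ (≤-<-trans (+-monoˡ-≤ _ (≮⇒≥ f0≮g0)) ∑f<∑g)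

pair≤sum : ∀ {n} (f : Fin n → ℕ) {a b} → a ≢ b → f a + f b ≤ sum f
pair≤sum f {zero}  {zero}  a≢b = ⊥-elim (a≢b refl)
pair≤sum f {zero}  {suc b} _   = +-monoʳ-≤ (f zero) (term≤sum (λ x → f (suc x)) b)
pair≤sum f {suc a} {zero}  _   =
  subst (_≤ sum f) (+-comm (f zero) _) (+-monoʳ-≤ (f zero) (term≤sum (λ x → f (suc x)) a))
pair≤sum f {suc a} {suc b} a≢b =
  ≤-trans (pair≤sum (λ x → f (suc x)) (λ a≡b → a≢b (cong suc a≡b))) (m≤n+m _ (f zero))

module _ {o ℓ} (M : CommutativeMonoid o ℓ) where

  open CommutativeMonoid M using (Carrier; _≈_; _∙_; ∙-cong; ∙-congˡ; assoc; setoid)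
  open CommutativeMonoidSum M using () renaming (sum to ∑; sum-remove to ∑-remove; sum-cong-≋ to ∑-cong-≋)
  open import Relation.Binary.Reasoning.Setoid setoid

  ∑-update : ∀ {n} {x : Fin n} {f g : Fin n → Carrier} → (∀ y → y ≢ x → f y ≈ g y) →
                  ∀ c → f x ≈ c ∙ g x → ∑ f ≈ c ∙ ∑ g
  ∑-update {suc n} {x} {f} {g} f≈g c fx = begin
    ∑ f                                    ≈⟨ ∑-remove {i = x} f ⟩
    f x ∙ ∑ (λ j → f (punchIn x j))        ≈⟨ ∙-cong fx (∑-cong-≋ (λ j → f≈g _ (punchInᵢ≢i x j))) ⟩
    c ∙ g x ∙ ∑ (λ j → g (punchIn x j))    ≈⟨ assoc c (g x) _ ⟩
    c ∙ (g x ∙ ∑ (λ j → g (punchIn x j)))  ≈⟨ ∙-congˡ (∑-remove {i = x} g) ⟨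
    c ∙ ∑ g                                ∎

sum-update : ∀ {n} {x : Fin n} {f g : Fin n → ℕ} → (∀ y → y ≢ x → f y ≡ g y) →
             ∀ c → f x ≡ c + g x → sum f ≡ c + sum g
sum-update = ∑-update +-0-commutativeMonoid

product-update : ∀ {n} {x : Fin n} {f g : Fin n → ℕ} → (∀ y → y ≢ x → f y ≡ g y) →
                 ∀ c → f x ≡ c * g x → product f ≡ c * product g
product-update = ∑-update *-1-commutativeMonoid

product-ones : ∀ n → product {n} (λ _ → 1) ≡ 1
product-ones zero    = refl
product-ones (suc n) = cong (_+ 0) (product-ones n)

erase : ∀ {n} → Fin n → (Fin n → ℕ) → Fin n → ℕ
erase x f = updateAt f x (λ _ → 0)

sum-erase : ∀ {n} (x : Fin n) (f : Fin n → ℕ) → sum f ≡ f x + sum (erase x f)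
sum-erase x f = sum-update (λ y y≢x → sym (updateAt-minimal y x f y≢x)) (f x)
  (trans (sym (+-identityʳ (f x))) (cong (f x +_) (sym (updateAt-updates x f))))

erase-other : ∀ {n} {x y : Fin n} (f : Fin n → ℕ) → y ≢ x → erase x f y ≡ f y
erase-other f y≢x = updateAt-minimal _ _ f y≢x

erase-positive : ∀ {n} {x y : Fin n} (f : Fin n → ℕ) → 1 ≤ erase x f y → y ≢ x × 1 ≤ f y
erase-positive {x = x} {y} f 1≤fy′ = y≢x , subst (1 ≤_) (erase-other f y≢x) 1≤fy′
  where
  y≢x : y ≢ x
  y≢x refl = <⇒≱ 1≤fy′ (≤-reflexive (updateAt-updates x f))

other-positive : ∀ {n} (f : Fin n → ℕ) {a} → f a < sum f → ∃ λ b → b ≢ a × 1 ≤ f b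
other-positive f {a} fa<∑f = let b , 1≤fb′ = sum-positive (erase a f) 0<rest in b , erase-positive f 1≤fb′
  where
  0<rest : 0 < sum (erase a f)
  0<rest = +-cancelˡ-< (f a) 0 _ (subst₂ _<_ (sym (+-identityʳ (f a))) (sum-erase a f) fa<∑f)

third-positive : ∀ {n} (f : Fin n → ℕ) {a b} → a ≢ b → f a + f b < sum f → ∃ λ c → c ≢ a × c ≢ b × 1 ≤ f c
third-positive f {a} {b} a≢b fa+fb<∑f =
  let c , c≢b , 1≤fc′ = other-positive (erase a f) fb<rest
      c≢a , 1≤fc     = erase-positive f 1≤fc′
  in c , c≢a , c≢b , 1≤fc
  where
  fb<rest : erase a f b < sum (erase a f)
  fb<rest = +-cancelˡ-< (f a) _ _
    (subst₂ (λ u v → f a + u < v) (sym (erase-other f (a≢b ∘′ sym))) (sum-erase a f) fa+fb<∑f)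

zero-outside : ∀ {n} (f : Fin n → ℕ) {a b} → a ≢ b → sum f ≡ f a + f b → ∀ c → c ≢ a → c ≢ b → f c ≡ 0
zero-outside f {a} {b} a≢b ∑f≡fa+fb c c≢a c≢b =
  trans (sym (trans (erase-other _ c≢b) (erase-other f c≢a))) (sum-zero⁻ (erase b (erase a f)) rest≡0 c)
  where
  rest≡0 : sum (erase b (erase a f)) ≡ 0
  rest≡0 = +-cancelˡ-≡ (f a + f b) _ 0 (begin
    f a + f b + sum (erase b (erase a f))
      ≡⟨ cong (λ u → f a + u + sum (erase b (erase a f))) (erase-other f (a≢b ∘′ sym)) ⟨
    f a + erase a f b + sum (erase b (erase a f))  ≡⟨ +-assoc (f a) _ _ ⟩
    f a + (erase a f b + sum (erase b (erase a f))) ≡⟨ cong (f a +_) (sum-erase b (erase a f)) ⟨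
    f a + sum (erase a f)                          ≡⟨ sum-erase a f ⟨
    sum f                                          ≡⟨ trans ∑f≡fa+fb (sym (+-identityʳ _)) ⟩
    f a + f b + 0                                  ∎)
    where open ≡-Reasoning

-- Graphs as adjacency matrices

indicator : Bool → ℕ
indicator b = if b then 1 else 0

fromEntries : ∀ {n} → (Fin n → Fin n → Bool) → Graph n
fromEntries f = Vec.tabulate (λ a → Vec.tabulate (f a))

entry-fromEntries : ∀ {n} (f : Fin n → Fin n → Bool) a b → entry (fromEntries f) a b ≡ f a b
entry-fromEntries f a b =
  trans (cong (λ row → lookup row b) (lookup∘tabulate (λ a → Vec.tabulate (f a)) a))
        (lookup∘tabulate (f a) b)

fromEntries-entry : ∀ {n} (G : Graph n) → fromEntries (entry G) ≡ G
fromEntries-entry G =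
  trans (tabulate-cong (λ a → tabulate∘lookup (lookup G a))) (tabulate∘lookup G)

graph-ext : ∀ {n} {G H : Graph n} → (∀ a b → entry G a b ≡ entry H a b) → G ≡ H
graph-ext {G = G} {H} G≈H = begin
  G                      ≡⟨ fromEntries-entry G ⟨
  fromEntries (entry G)  ≡⟨ tabulate-cong (λ a → tabulate-cong (G≈H a)) ⟩
  fromEntries (entry H)  ≡⟨ fromEntries-entry H ⟩
  H                      ∎
  where open ≡-Reasoning

emptyGraph : ∀ {n} → Graph n
emptyGraph = fromEntries (λ _ _ → false)

deg-sum : ∀ {n} (G : Graph n) a → deg G a ≡ sum (λ b → indicator (entry G a b))
deg-sum G a = trans (sum-lookup (Vec.map indicator (lookup G a)))
                    (sum-cong-≗ (λ b → lookup-map b indicator (lookup G a)))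

deg-differ-at : ∀ {n} (G H : Graph n) {a x} → (∀ y → y ≢ x → entry H a y ≡ entry G a y) → entry G a x ≡ false →
                deg H a ≡ indicator (entry H a x) + deg G a
deg-differ-at G H {a} {x} H≈G ¬ax = begin
  deg H a                                                     ≡⟨ deg-sum H a ⟩
  sum (λ y → indicator (entry H a y))                         ≡⟨ sum-update (λ y y≢x → cong indicator (H≈G y y≢x)) _ at-x ⟩
  indicator (entry H a x) + sum (λ y → indicator (entry G a y)) ≡⟨ cong (indicator (entry H a x) +_) (deg-sum G a) ⟨
  indicator (entry H a x) + deg G a                           ∎
  where
  open ≡-Reasoning
  at-x : indicator (entry H a x) ≡ indicator (entry H a x) + indicator (entry G a x)
  at-x rewrite ¬ax = sym (+-identityʳ _)

module _ {n} {G : Graph n} where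

  adj-sym : SimpleGraph G → ∀ {a b} → Adj G a b → Adj G b a
  adj-sym S {a} {b} ab = trans (SimpleGraph.sym S b a) ab

  adj⇒≢ : SimpleGraph G → ∀ {a b} → Adj G a b → a ≢ b
  adj⇒≢ S {a} ab refl with trans (sym ab) (SimpleGraph.irrefl S a)
  ... | ()

module _ {n} (G : Graph n) where

  adj⇒1≤deg : ∀ {a b} → Adj G a b → 1 ≤ deg G a
  adj⇒1≤deg {a} {b} ab = subst (1 ≤_) (sym (deg-sum G a))
    (≤-trans (≤-reflexive (cong indicator (sym ab))) (term≤sum (λ c → indicator (entry G a c)) b))

  deg≡0⇒no-adj : ∀ {a} → deg G a ≡ 0 → ∀ b → entry G a b ≡ false
  deg≡0⇒no-adj {a} deg≡0 b with entry G a b in eq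
  ... | false = refl
  ... | true  = ⊥-elim (<⇒≱ (adj⇒1≤deg eq) (≤-reflexive deg≡0))

  neighbour : ∀ {a} → 1 ≤ deg G a → ∃ λ b → Adj G a b
  neighbour {a} 1≤deg with sum-positive (λ b → indicator (entry G a b)) (subst (1 ≤_) (deg-sum G a) 1≤deg)
  ... | b , 1≤[ab] = b , indicator≥1 1≤[ab]
    where
    indicator≥1 : ∀ {x} → 1 ≤ indicator x → x ≡ true
    indicator≥1 {true} _ = refl

  leaf-neighbour-unique : ∀ {ℓ k x} → deg G ℓ ≡ 1 → Adj G ℓ k → Adj G ℓ x → x ≡ k
  leaf-neighbour-unique {ℓ} {k} {x} deg≡1 ℓk ℓx with x ≟ k
  ... | yes x≡k = x≡k
  ... | no  x≢k = ⊥-elim (<⇒≱ (s≤s (s≤s z≤n)) 2≤1)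
    where
    2≤1 : 2 ≤ 1
    2≤1 = subst₂ _≤_ (cong₂ _+_ (cong indicator ℓx) (cong indicator ℓk)) (trans (sym (deg-sum G ℓ)) deg≡1)
            (pair≤sum (λ c → indicator (entry G ℓ c)) x≢k)

walk-map : ∀ {n} {G H : Graph n} → (∀ {a b} → Adj G a b → Adj H a b) → ∀ {a b} → Walk G a b → Walk H a b
walk-map G⊆H here       = here
walk-map G⊆H (step e w) = step (G⊆H e) (walk-map G⊆H w)

_++ʷ_ : ∀ {n} {G : Graph n} {a b c} → Walk G a b → Walk G b c → Walk G a c
here     ++ʷ w′ = w′
step e w ++ʷ w′ = step e (w ++ʷ w′)

reverse-walk : ∀ {n} {G : Graph n} → SimpleGraph G → ∀ {a b} → Walk G a b → Walk G b a
reverse-walk {G = G} S w = go w here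
  where
  go : ∀ {a b c} → Walk G a b → Walk G a c → Walk G b c
  go here       acc = acc
  go (step e w) acc = go w (step (adj-sym S e) acc)

data LastOrInject₁ : ∀ {m} → Fin (suc m) → Set where
  last    : ∀ {m} → LastOrInject₁ (fromℕ m)
  inject₁ : ∀ {m} (p : Fin m) → LastOrInject₁ (Fin.inject₁ p)

lastOrInject₁ : ∀ {m} (p : Fin (suc m)) → LastOrInject₁ p
lastOrInject₁ {zero}  zero    = last
lastOrInject₁ {suc m} zero    = inject₁ zero
lastOrInject₁ {suc m} (suc p) with lastOrInject₁ p
... | last      = last
... | inject₁ q = inject₁ (suc q)

module _ {n} {G : Graph n} (S : SimpleGraph G) where

  two-neighbours-on-cycle : ((k , vs , _) : HasCycle G) → ∀ p →
    Σ (Fin n) λ x → Σ (Fin n) λ y → x ≢ y × Adj G (lookup vs p) x × Adj G (lookup vs p) y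
  two-neighbours-on-cycle (k , vs , vs-injective , consecutive , closing) p = go p (lastOrInject₁ p)
    where
    distinct : ∀ {p q} → p ≢ q → lookup vs p ≢ lookup vs q
    distinct p≢q eq = p≢q (vs-injective _ _ eq)
    go : ∀ p → LastOrInject₁ p →
      Σ (Fin n) λ x → Σ (Fin n) λ y → x ≢ y × Adj G (lookup vs p) x × Adj G (lookup vs p) y
    go _ last =
      lookup vs zero , lookup vs (Fin.inject₁ (fromℕ (suc k))) , distinct (λ ()) , closing ,
      adj-sym S (consecutive (fromℕ (suc k)))
    go _ (inject₁ zero) =
      lookup vs (suc zero) , lookup vs (fromℕ (suc (suc k))) , distinct (λ ()) , consecutive zero ,
      adj-sym S closing
    go _ (inject₁ (suc q)) =
      lookup vs (suc (suc q)) , lookup vs (Fin.inject₁ (Fin.inject₁ q)) , distinct 2+q≢q ,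
      consecutive (suc q) , adj-sym S (consecutive (Fin.inject₁ q))
      where
      2+q≢q : suc (suc q) ≢ Fin.inject₁ (Fin.inject₁ q)
      2+q≢q eq = m≢1+n+m (toℕ q)
        (sym (trans (cong toℕ eq) (trans (toℕ-inject₁ (Fin.inject₁ q)) (toℕ-inject₁ q))))

  leaf-not-on-cycle : ∀ {ℓ k} → deg G ℓ ≡ 1 → Adj G ℓ k → ((_ , vs , _) : HasCycle G) → ∀ p → lookup vs p ≢ ℓ
  leaf-not-on-cycle {ℓ} {k} deg≡1 ℓk cycle p vp≡ℓ with two-neighbours-on-cycle cycle p
  ... | x , y , x≢y , vp~x , vp~y = x≢y (trans (unique vp~x) (sym (unique vp~y)))
    where
    unique : ∀ {z} → Adj G _ z → z ≡ k
    unique vp~z = leaf-neighbour-unique G deg≡1 ℓk (subst (λ v → Adj G v _) vp≡ℓ vp~z)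

acyclic-⊆ : ∀ {n} {G H : Graph n} → (∀ {a b} → Adj H a b → Adj G a b) → ¬ HasCycle G → ¬ HasCycle H
acyclic-⊆ H⊆G no-cycle (k , vs , injective , consecutive , closing) =
  no-cycle (k , vs , injective , (λ p → H⊆G (consecutive p)) , H⊆G closing)

-- Deleting and adding a leaf

prune : ∀ {n} → Fin n → Fin n → (Fin n → ℕ) → Fin n → ℕ
prune ℓ k D = erase ℓ (updateAt D k pred)

module _ {n} {ℓ k : Fin n} (D : Fin n → ℕ) where

  prune-ℓ : prune ℓ k D ℓ ≡ 0
  prune-ℓ = updateAt-updates ℓ _

  prune-k : k ≢ ℓ → prune ℓ k D k ≡ pred (D k)
  prune-k k≢ℓ = trans (updateAt-minimal k ℓ _ k≢ℓ) (updateAt-updates k D)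

  prune-other : ∀ {x} → x ≢ ℓ → x ≢ k → prune ℓ k D x ≡ D x
  prune-other {x} x≢ℓ x≢k = trans (updateAt-minimal x ℓ _ x≢ℓ) (updateAt-minimal x k D x≢k)

  prune-≤ : ∀ x → prune ℓ k D x ≤ D x
  prune-≤ x with x ≟ ℓ | x ≟ k
  ... | yes refl | _        = subst (_≤ D x) (sym prune-ℓ) z≤n
  ... | no x≢ℓ   | yes refl = ≤-trans (≤-reflexive (prune-k x≢ℓ)) pred[n]≤n
  ... | no x≢ℓ   | no x≢k   = ≤-reflexive (prune-other x≢ℓ x≢k)

  prune-positive : ∀ {x} → x ≢ ℓ → 2 ≤ D x → 1 ≤ prune ℓ k D x
  prune-positive {x} x≢ℓ 2≤Dx with x ≟ k
  ... | yes refl = subst (1 ≤_) (sym (prune-k x≢ℓ)) (suc[m]≤n⇒m≤pred[n] 2≤Dx)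
  ... | no x≢k   = subst (1 ≤_) (sym (prune-other x≢ℓ x≢k)) (≤-trans (s≤s z≤n) 2≤Dx)

isolate : ∀ {n} → Fin n → Graph n → Graph n
isolate ℓ G = fromEntries (λ a b → if does (a ≟ ℓ) ∨ does (b ≟ ℓ) then false else entry G a b)

module _ {n} (ℓ : Fin n) (G : Graph n) where

  isolate-entry : ∀ a b → entry (isolate ℓ G) a b ≡ (if does (a ≟ ℓ) ∨ does (b ≟ ℓ) then false else entry G a b)
  isolate-entry = entry-fromEntries (λ a b → if does (a ≟ ℓ) ∨ does (b ≟ ℓ) then false else entry G a b)

  isolate-row : ∀ b → entry (isolate ℓ G) ℓ b ≡ false
  isolate-row b rewrite isolate-entry ℓ b | dec-true (ℓ ≟ ℓ) refl = refl

  isolate-col : ∀ a → entry (isolate ℓ G) a ℓ ≡ false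
  isolate-col a rewrite isolate-entry a ℓ | dec-true (ℓ ≟ ℓ) refl | ∨-zeroʳ (does (a ≟ ℓ)) = refl

  isolate-elsewhere : ∀ {a b} → a ≢ ℓ → b ≢ ℓ → entry (isolate ℓ G) a b ≡ entry G a b
  isolate-elsewhere {a} {b} a≢ℓ b≢ℓ
    rewrite isolate-entry a b | dec-false (a ≟ ℓ) a≢ℓ | dec-false (b ≟ ℓ) b≢ℓ = refl

  isolate-⊆ : ∀ {a b} → Adj (isolate ℓ G) a b → Adj G a b
  isolate-⊆ {a} {b} ab with a ≟ ℓ | b ≟ ℓ
  ... | yes refl | _        = contradiction (trans (sym (isolate-row b)) ab) λ ()
  ... | no _     | yes refl = contradiction (trans (sym (isolate-col a)) ab) λ ()
  ... | no a≢ℓ   | no b≢ℓ   = trans (sym (isolate-elsewhere a≢ℓ b≢ℓ)) ab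

isEdge : ∀ {n} → Fin n → Fin n → Fin n → Fin n → Bool
isEdge ℓ k a b = does (a ≟ ℓ) ∧ does (b ≟ k) ∨ does (a ≟ k) ∧ does (b ≟ ℓ)

≟-∧-false : ∀ {n} {x y u v : Fin n} → (x ≢ u ⊎ y ≢ v) → does (x ≟ u) ∧ does (y ≟ v) ≡ false
≟-∧-false             (inj₁ x≢u) rewrite dec-false (_ ≟ _) x≢u = refl
≟-∧-false {x = x} {u = u} (inj₂ y≢v) rewrite dec-false (_ ≟ _) y≢v = ∧-zeroʳ (does (x ≟ u))

addEdge : ∀ {n} → Fin n → Fin n → Graph n → Graph n
addEdge ℓ k G = fromEntries (λ a b → isEdge ℓ k a b ∨ entry G a b)

module _ {n} (ℓ k : Fin n) (G : Graph n) where

  addEdge-entry : ∀ a b → entry (addEdge ℓ k G) a b ≡ isEdge ℓ k a b ∨ entry G a b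
  addEdge-entry = entry-fromEntries (λ a b → isEdge ℓ k a b ∨ entry G a b)

  addEdge-ℓk : Adj (addEdge ℓ k G) ℓ k
  addEdge-ℓk rewrite addEdge-entry ℓ k | dec-true (ℓ ≟ ℓ) refl | dec-true (k ≟ k) refl = refl

  addEdge-kℓ : Adj (addEdge ℓ k G) k ℓ
  addEdge-kℓ rewrite addEdge-entry k ℓ | dec-true (k ≟ k) refl | dec-true (ℓ ≟ ℓ) refl
                   | ∨-zeroʳ (does (k ≟ ℓ) ∧ does (ℓ ≟ k)) = refl

  addEdge-⊇ : ∀ {a b} → Adj G a b → Adj (addEdge ℓ k G) a b
  addEdge-⊇ {a} {b} ab rewrite addEdge-entry a b | ab = ∨-zeroʳ (isEdge ℓ k a b)

  addEdge-elsewhere : ∀ {a b} → (a ≢ ℓ ⊎ b ≢ k) → (a ≢ k ⊎ b ≢ ℓ) → entry (addEdge ℓ k G) a b ≡ entry G a b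
  addEdge-elsewhere {a} {b} aℓ≢ ab≢ rewrite addEdge-entry a b | ≟-∧-false aℓ≢ | ≟-∧-false ab≢ = refl

  addEdge-simple : SimpleGraph G → ℓ ≢ k → SimpleGraph (addEdge ℓ k G)
  addEdge-simple S ℓ≢k = record { sym = symmetric ; irrefl = irreflexive }
    where
    symmetric : ∀ a b → entry (addEdge ℓ k G) a b ≡ entry (addEdge ℓ k G) b a
    symmetric a b rewrite addEdge-entry a b | addEdge-entry b a | SimpleGraph.sym S a b
      | ∧-comm (does (a ≟ ℓ)) (does (b ≟ k)) | ∧-comm (does (a ≟ k)) (does (b ≟ ℓ))
      = cong (_∨ entry G b a) (∨-comm (does (b ≟ k) ∧ does (a ≟ ℓ)) _)
    irreflexive : ∀ a → entry (addEdge ℓ k G) a a ≡ false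
    irreflexive a with a ≟ ℓ
    ... | yes refl = trans (addEdge-elsewhere (inj₂ ℓ≢k) (inj₁ ℓ≢k)) (SimpleGraph.irrefl S a)
    ... | no a≢ℓ   = trans (addEdge-elsewhere (inj₁ a≢ℓ) (inj₂ a≢ℓ)) (SimpleGraph.irrefl S a)

module _ {n} {ℓ k : Fin n} {G : Graph n} where

  addEdge-isolate : SimpleGraph G → deg G ℓ ≡ 1 → Adj G ℓ k → addEdge ℓ k (isolate ℓ G) ≡ G
  addEdge-isolate S deg≡1 ℓk = graph-ext entries
    where
    ℓ≢k : ℓ ≢ k
    ℓ≢k = adj⇒≢ S ℓk
    only-k : ∀ {b} → b ≢ k → entry G ℓ b ≡ false
    only-k b≢k = ¬-not (b≢k ∘′ leaf-neighbour-unique G deg≡1 ℓk)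
    entries : ∀ a b → entry (addEdge ℓ k (isolate ℓ G)) a b ≡ entry G a b
    entries a b with a ≟ ℓ | b ≟ ℓ
    entries a b | yes refl | _ with b ≟ k
    ... | yes refl = trans (addEdge-ℓk ℓ k (isolate ℓ G)) (sym ℓk)
    ... | no b≢k   = trans (addEdge-elsewhere ℓ k (isolate ℓ G) (inj₂ b≢k) (inj₁ ℓ≢k))
                           (trans (isolate-row ℓ G b) (sym (only-k b≢k)))
    entries a b | no a≢ℓ | yes refl with a ≟ k
    ... | yes refl = trans (addEdge-kℓ ℓ k (isolate ℓ G)) (sym (adj-sym S ℓk))
    ... | no a≢k   = trans (addEdge-elsewhere ℓ k (isolate ℓ G) (inj₁ a≢ℓ) (inj₁ a≢k))
                       (trans (isolate-col ℓ G a) (sym (trans (SimpleGraph.sym S a ℓ) (only-k a≢k))))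
    entries a b | no a≢ℓ | no b≢ℓ =
      trans (addEdge-elsewhere ℓ k (isolate ℓ G) (inj₁ a≢ℓ) (inj₂ b≢ℓ)) (isolate-elsewhere ℓ G a≢ℓ b≢ℓ)

  isolate-addEdge : SimpleGraph G → deg G ℓ ≡ 0 → isolate ℓ (addEdge ℓ k G) ≡ G
  isolate-addEdge S deg≡0 = graph-ext entries
    where
    row-ℓ : ∀ b → entry G ℓ b ≡ false
    row-ℓ = deg≡0⇒no-adj G deg≡0
    entries : ∀ a b → entry (isolate ℓ (addEdge ℓ k G)) a b ≡ entry G a b
    entries a b with a ≟ ℓ | b ≟ ℓ
    ... | yes refl | _        = trans (isolate-row ℓ (addEdge ℓ k G) b) (sym (row-ℓ b))
    ... | no _     | yes refl = trans (isolate-col ℓ (addEdge ℓ k G) a) (sym (trans (SimpleGraph.sym S a ℓ) (row-ℓ a)))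
    ... | no a≢ℓ   | no b≢ℓ   =
      trans (isolate-elsewhere ℓ (addEdge ℓ k G) a≢ℓ b≢ℓ) (addEdge-elsewhere ℓ k G (inj₁ a≢ℓ) (inj₂ b≢ℓ))

module _ {n} (ℓ : Fin n) {G : Graph n} (S : SimpleGraph G) where

  isolate-simple : SimpleGraph (isolate ℓ G)
  isolate-simple = record { sym = symmetric ; irrefl = irreflexive }
    where
    symmetric : ∀ a b → entry (isolate ℓ G) a b ≡ entry (isolate ℓ G) b a
    symmetric a b with a ≟ ℓ | b ≟ ℓ
    ... | yes refl | _        = trans (isolate-row ℓ G b) (sym (isolate-col ℓ G b))
    ... | no _     | yes refl = trans (isolate-col ℓ G a) (sym (isolate-row ℓ G a))
    ... | no a≢ℓ   | no b≢ℓ   =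
      trans (isolate-elsewhere ℓ G a≢ℓ b≢ℓ) (trans (SimpleGraph.sym S a b) (sym (isolate-elsewhere ℓ G b≢ℓ a≢ℓ)))
    irreflexive : ∀ a → entry (isolate ℓ G) a a ≡ false
    irreflexive a with a ≟ ℓ
    ... | yes refl = isolate-row ℓ G a
    ... | no a≢ℓ   = trans (isolate-elsewhere ℓ G a≢ℓ a≢ℓ) (SimpleGraph.irrefl S a)

  deg-isolate-ℓ : deg (isolate ℓ G) ℓ ≡ 0
  deg-isolate-ℓ = trans (deg-sum (isolate ℓ G) ℓ) (sum-zero _ (λ b → cong indicator (isolate-row ℓ G b)))

  deg-isolate : ∀ {a} → a ≢ ℓ → deg G a ≡ indicator (entry G a ℓ) + deg (isolate ℓ G) a
  deg-isolate {a} a≢ℓ = deg-differ-at (isolate ℓ G) G (λ b b≢ℓ → sym (isolate-elsewhere ℓ G a≢ℓ b≢ℓ)) (isolate-col ℓ G a)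

  module _ {k} (deg≡1 : deg G ℓ ≡ 1) (ℓk : Adj G ℓ k) where

    private
      into-ℓ : ∀ {a} → Adj G a ℓ → a ≡ k
      into-ℓ aℓ = leaf-neighbour-unique G deg≡1 ℓk (adj-sym S aℓ)

    -- A walk through ℓ enters and leaves it via k, so the visit to ℓ can be cut out.
    walk-avoiding-leaf : ∀ {a b} → a ≢ ℓ → b ≢ ℓ → Walk G a b → Walk (isolate ℓ G) a b
    walk-avoiding-leaf a≢ℓ b≢ℓ here = here
    walk-avoiding-leaf {a} a≢ℓ b≢ℓ (step {j = x} ax w) with x ≟ ℓ
    ... | no x≢ℓ = step (trans (isolate-elsewhere ℓ G a≢ℓ x≢ℓ) ax) (walk-avoiding-leaf x≢ℓ b≢ℓ w)
    walk-avoiding-leaf a≢ℓ b≢ℓ (step ax here) | yes refl = ⊥-elim (b≢ℓ refl)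
    walk-avoiding-leaf a≢ℓ b≢ℓ (step ax (step {j = y} ℓy w)) | yes refl =
      subst (λ v → Walk (isolate ℓ G) v _) (trans (leaf-neighbour-unique G deg≡1 ℓk ℓy) (sym (into-ℓ ax)))
        (walk-avoiding-leaf (adj⇒≢ S ℓy ∘′ sym) b≢ℓ w)

    deg-isolate-neighbour : deg G k ≡ suc (deg (isolate ℓ G) k)
    deg-isolate-neighbour =
      trans (deg-isolate (adj⇒≢ S ℓk ∘′ sym)) (cong (λ e → indicator e + deg (isolate ℓ G) k) (adj-sym S ℓk))

    deg-isolate-other : ∀ {a} → a ≢ ℓ → a ≢ k → deg G a ≡ deg (isolate ℓ G) a
    deg-isolate-other {a} a≢ℓ a≢k = trans (deg-isolate a≢ℓ) (cong (λ e → indicator e + deg (isolate ℓ G) a) no-aℓ)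
      where
      no-aℓ : entry G a ℓ ≡ false
      no-aℓ = ¬-not (a≢k ∘′ into-ℓ)

-- Trees spanning the support of a degree sequence

-- Only vertices of positive degree must be connected, so pruning a leaf keeps the vertex set Fin n.
record TreeOn {n} (D : Fin n → ℕ) (G : Graph n) : Set where
  field
    simple    : SimpleGraph G
    degrees   : HasDegrees G D
    connected : ∀ a b → 1 ≤ D a → 1 ≤ D b → Walk G a b
    acyclic   : ¬ HasCycle G

isTree⇒treeOn : ∀ {n} {D : Fin n → ℕ} {G} → IsTree G × HasDegrees G D → TreeOn D G
isTree⇒treeOn ((S , C , A) , H) = record { simple = S ; degrees = H ; connected = λ a b _ _ → C a b ; acyclic = A }

treeOn⇒isTree : ∀ {n} {D : Fin n → ℕ} {G} → (∀ x → 1 ≤ D x) → TreeOn D G → IsTree G × HasDegrees G D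
treeOn⇒isTree D-positive T =
  (TreeOn.simple T , (λ a b → TreeOn.connected T a b (D-positive a) (D-positive b)) , TreeOn.acyclic T) ,
  TreeOn.degrees T

module _ {n} {D : Fin n → ℕ} (D≡0 : ∀ x → D x ≡ 0) where

  emptyGraph-tree : TreeOn D emptyGraph
  emptyGraph-tree = record
    { simple    = record { sym = λ a b → trans (no-edge a b) (sym (no-edge b a)) ; irrefl = λ a → no-edge a a }
    ; degrees   = λ a → trans (deg-sum emptyGraph a)
                            (trans (sum-zero _ (λ b → cong indicator (no-edge a b))) (sym (D≡0 a)))
    ; connected = λ a _ 1≤Da _ → ⊥-elim (<⇒≱ 1≤Da (≤-reflexive (D≡0 a)))
    ; acyclic   = λ (_ , vs , _ , _ , closing) → contradiction (trans (sym (no-edge _ _)) closing) λ ()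
    }
    where
    no-edge : ∀ a b → entry (emptyGraph {n}) a b ≡ false
    no-edge = entry-fromEntries (λ _ _ → false)

  degrees-zero⇒empty : ∀ G → HasDegrees G D → G ≡ emptyGraph
  degrees-zero⇒empty G degrees = graph-ext λ a b →
    trans (deg≡0⇒no-adj G (trans (degrees a) (D≡0 a)) b) (sym (entry-fromEntries (λ _ _ → false) a b))

isolate-leaf : ∀ {n} {D : Fin n → ℕ} {G ℓ k} → TreeOn D G → D ℓ ≡ 1 → Adj G ℓ k → TreeOn (prune ℓ k D) (isolate ℓ G)
isolate-leaf {D = D} {G} {ℓ} {k} T Dℓ≡1 ℓk = record
  { simple    = isolate-simple ℓ S
  ; degrees   = degrees′
  ; connected = connected
  ; acyclic   = acyclic-⊆ {G = G} {H = isolate ℓ G} (isolate-⊆ ℓ G) (TreeOn.acyclic T)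
  }
  where
  open TreeOn T using (degrees) renaming (simple to S)
  deg≡1 : deg G ℓ ≡ 1
  deg≡1 = trans (degrees ℓ) Dℓ≡1
  k≢ℓ : k ≢ ℓ
  k≢ℓ = adj⇒≢ S ℓk ∘′ sym
  degrees′ : HasDegrees (isolate ℓ G) (prune ℓ k D)
  degrees′ a with a ≟ ℓ | a ≟ k
  ... | yes refl | _        = trans (deg-isolate-ℓ ℓ S) (sym (prune-ℓ D))
  ... | no a≢ℓ   | yes refl =
    trans (cong pred (trans (sym (deg-isolate-neighbour ℓ S deg≡1 ℓk)) (degrees k))) (sym (prune-k D k≢ℓ))
  ... | no a≢ℓ   | no a≢k   =
    trans (sym (deg-isolate-other ℓ S deg≡1 ℓk a≢ℓ a≢k)) (trans (degrees a) (sym (prune-other D a≢ℓ a≢k)))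
  positive⇒≢ℓ : ∀ {a} → 1 ≤ prune ℓ k D a → a ≢ ℓ
  positive⇒≢ℓ 1≤ refl = <⇒≱ 1≤ (≤-reflexive (prune-ℓ D))
  connected : ∀ a b → 1 ≤ prune ℓ k D a → 1 ≤ prune ℓ k D b → Walk (isolate ℓ G) a b
  connected a b 1≤a 1≤b = walk-avoiding-leaf ℓ S deg≡1 ℓk (positive⇒≢ℓ 1≤a) (positive⇒≢ℓ 1≤b)
    (TreeOn.connected T a b (≤-trans 1≤a (prune-≤ D a)) (≤-trans 1≤b (prune-≤ D b)))

addEdge-degrees : ∀ {n} {D : Fin n → ℕ} {G ℓ k} → SimpleGraph G → ℓ ≢ k → D ℓ ≡ 1 → 1 ≤ D k →
                  HasDegrees G (prune ℓ k D) → HasDegrees (addEdge ℓ k G) D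
addEdge-degrees {n} {D} {G} {ℓ} {k} S ℓ≢k Dℓ≡1 1≤Dk degrees = degrees′
  where
  open ≡-Reasoning
  X : Graph n
  X = addEdge ℓ k G
  k≢ℓ : k ≢ ℓ
  k≢ℓ = ℓ≢k ∘′ sym
  row-ℓ : ∀ b → entry G ℓ b ≡ false
  row-ℓ = deg≡0⇒no-adj G (trans (degrees ℓ) (prune-ℓ D))
  degrees′ : HasDegrees X D
  degrees′ a with a ≟ ℓ | a ≟ k
  ... | yes refl | _        = begin
    deg X ℓ                           ≡⟨ deg-differ-at G X (λ y y≢k → addEdge-elsewhere ℓ k G (inj₂ y≢k) (inj₁ ℓ≢k)) (row-ℓ k) ⟩
    indicator (entry X ℓ k) + deg G ℓ ≡⟨ cong₂ (λ e d → indicator e + d) (addEdge-ℓk ℓ k G) (trans (degrees ℓ) (prune-ℓ D)) ⟩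
    1                                 ≡⟨ Dℓ≡1 ⟨
    D ℓ                               ∎
  ... | no _     | yes refl = begin
    deg X k                           ≡⟨ deg-differ-at G X (λ y y≢ℓ → addEdge-elsewhere ℓ k G (inj₁ k≢ℓ) (inj₂ y≢ℓ))
                                                         (trans (SimpleGraph.sym S k ℓ) (row-ℓ k)) ⟩
    indicator (entry X k ℓ) + deg G k ≡⟨ cong₂ (λ e d → indicator e + d) (addEdge-kℓ ℓ k G) (trans (degrees k) (prune-k D k≢ℓ)) ⟩
    suc (pred (D k))                  ≡⟨ suc-pred (D k) {{>-nonZero 1≤Dk}} ⟩
    D k                               ∎
  ... | no a≢ℓ   | no a≢k   = begin
    deg X a                                ≡⟨ deg-sum X a ⟩
    sum (λ b → indicator (entry X a b))
      ≡⟨ sum-cong-≗ (λ b → cong indicator (addEdge-elsewhere ℓ k G {a} {b} (inj₁ a≢ℓ) (inj₁ a≢k))) ⟩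
    sum (λ b → indicator (entry G a b))    ≡⟨ deg-sum G a ⟨
    deg G a                                ≡⟨ trans (degrees a) (prune-other D a≢ℓ a≢k) ⟩
    D a                                    ∎

-- The disjunction makes k reach the other vertices: either k keeps positive degree after the
-- pruning, or ℓ and k are the only vertices of positive degree.
addEdge-leaf : ∀ {n} {D : Fin n → ℕ} {G ℓ k} → ℓ ≢ k → D ℓ ≡ 1 → 1 ≤ D k → TreeOn (prune ℓ k D) G →
  (1 ≤ pred (D k) ⊎ (∀ b → b ≢ ℓ → b ≢ k → D b ≡ 0)) → TreeOn D (addEdge ℓ k G)
addEdge-leaf {n} {D} {G} {ℓ} {k} ℓ≢k Dℓ≡1 1≤Dk T k-reaches = record
  { simple    = S′
  ; degrees   = degrees′
  ; connected = λ a b 1≤Da 1≤Db → reverse-walk S′ (from-k 1≤Da) ++ʷ from-k 1≤Db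
  ; acyclic   = acyclic′
  }
  where
  open TreeOn T using (degrees) renaming (simple to S)
  X : Graph n
  X = addEdge ℓ k G
  S′ : SimpleGraph X
  S′ = addEdge-simple ℓ k G S ℓ≢k
  k≢ℓ : k ≢ ℓ
  k≢ℓ = ℓ≢k ∘′ sym
  degrees′ : HasDegrees X D
  degrees′ = addEdge-degrees S ℓ≢k Dℓ≡1 1≤Dk degrees
  from-k : ∀ {b} → 1 ≤ D b → Walk X k b
  from-k {b} 1≤Db with b ≟ ℓ | b ≟ k
  ... | yes refl | _        = step (addEdge-kℓ ℓ k G) here
  ... | no _     | yes refl = here
  ... | no b≢ℓ   | no b≢k   = [ through-G , absent ]′ k-reaches
    where
    absent : (∀ c → c ≢ ℓ → c ≢ k → D c ≡ 0) → Walk X k b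
    absent others-0 = ⊥-elim (<⇒≱ 1≤Db (≤-reflexive (others-0 b b≢ℓ b≢k)))
    through-G : 1 ≤ pred (D k) → Walk X k b
    through-G 1≤pred-Dk = walk-map (addEdge-⊇ ℓ k G)
      (TreeOn.connected T k b (subst (1 ≤_) (sym (prune-k D k≢ℓ)) 1≤pred-Dk)
                              (subst (1 ≤_) (sym (prune-other D b≢ℓ b≢k)) 1≤Db))
  acyclic′ : ¬ HasCycle X
  acyclic′ cycle@(m , vs , injective , consecutive , closing) =
    TreeOn.acyclic T (m , vs , injective , (λ p → in-G (consecutive p)) , in-G closing)
    where
    off-ℓ : ∀ p → lookup vs p ≢ ℓ
    off-ℓ = leaf-not-on-cycle S′ (trans (degrees′ ℓ) Dℓ≡1) (addEdge-ℓk ℓ k G) cycle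
    in-G : ∀ {p q} → Adj X (lookup vs p) (lookup vs q) → Adj G (lookup vs p) (lookup vs q)
    in-G {p} {q} e = trans (sym (addEdge-elsewhere ℓ k G (inj₁ (off-ℓ p)) (inj₂ (off-ℓ q)))) e

-- Two adjacent leaves form a whole component, which a third vertex of positive degree rules out.
leaf-neighbour-2≤deg : ∀ {n} {D : Fin n → ℕ} {G ℓ k} → TreeOn D G → D ℓ ≡ 1 → Adj G ℓ k →
  (∃ λ c → c ≢ ℓ × c ≢ k × 1 ≤ D c) → 2 ≤ D k
leaf-neighbour-2≤deg {D = D} {G} {ℓ} {k} T Dℓ≡1 ℓk (c , c≢ℓ , c≢k , 1≤Dc) with D k in Dk≡
... | zero        = ⊥-elim (<⇒≱ (subst (1 ≤_) (trans (degrees k) Dk≡) (adj⇒1≤deg G (adj-sym S ℓk))) ≤-refl)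
  where open TreeOn T using (degrees) renaming (simple to S)
... | suc zero    =
  ⊥-elim ([ c≢ℓ , c≢k ]′ (trapped (inj₁ refl) (TreeOn.connected T ℓ c (≤-reflexive (sym Dℓ≡1)) 1≤Dc)))
  where
  open TreeOn T using (degrees) renaming (simple to S)
  trapped : ∀ {x y} → x ≡ ℓ ⊎ x ≡ k → Walk G x y → y ≡ ℓ ⊎ y ≡ k
  trapped x∈ here = x∈
  trapped (inj₁ refl) (step ℓy w) =
    trapped (inj₂ (leaf-neighbour-unique G (trans (degrees ℓ) Dℓ≡1) ℓk ℓy)) w
  trapped (inj₂ refl) (step ky w) =
    trapped (inj₁ (leaf-neighbour-unique G (trans (degrees k) Dk≡) (adj-sym S ℓk) ky)) w
... | suc (suc _) = s≤s (s≤s z≤n)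

-- Degree sequences of trees

sign : ℕ → ℕ
sign zero    = 0
sign (suc _) = 1

-- A tree on the s + 2 vertices where D is positive has Σ (d − 1) = s; as pred 0 = 0 the sum may
-- run over all of Fin n.
record IsTreeSequence {n} (s : ℕ) (D : Fin n → ℕ) : Set where
  field
    support : sum (λ x → sign (D x)) ≡ 2 + s
    excess  : sum (λ x → pred (D x)) ≡ s

weight : ∀ {n} → (Fin n → ℕ) → ℕ
weight D = product (λ x → pred (D x) !)

1≤weight : ∀ {n} (D : Fin n → ℕ) → 1 ≤ weight D
1≤weight {zero}  D = ≤-refl
1≤weight {suc n} D = *-mono-≤ (1≤n! (pred (D zero))) (1≤weight (λ x → D (suc x)))

module _ {n} {s} {D : Fin n → ℕ} (seq : IsTreeSequence s D) where

  open IsTreeSequence seq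

  leaf-exists : ∃ λ ℓ → D ℓ ≡ 1
  leaf-exists =
    let ℓ , pred<sign = sum-< (λ x → pred (D x)) (λ x → sign (D x)) excess<support in ℓ , leaf pred<sign
    where
    excess<support : sum (λ x → pred (D x)) < sum (λ x → sign (D x))
    excess<support = subst₂ _<_ (sym excess) (sym support) (m≤n+m (suc s) 1)
    leaf : ∀ {d} → pred d < sign d → d ≡ 1
    leaf {suc zero}    _          = refl
    leaf {suc (suc _)} (s≤s ())

module _ {n} {s} {D : Fin n → ℕ} (seq : IsTreeSequence (suc s) D) where

  open IsTreeSequence seq

  third-vertex : ∀ {a b} → a ≢ b → ∃ λ c → c ≢ a × c ≢ b × 1 ≤ D c
  third-vertex {a} {b} a≢b =
    let c , c≢a , c≢b , 1≤sign = third-positive (λ x → sign (D x)) a≢b sign-a+sign-b<support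
    in c , c≢a , c≢b , sign-positive 1≤sign
    where
    sign≤1 : ∀ d → sign d ≤ 1
    sign≤1 zero    = z≤n
    sign≤1 (suc _) = ≤-refl
    sign-positive : ∀ {d} → 1 ≤ sign d → 1 ≤ d
    sign-positive {suc _} _ = s≤s z≤n
    sign-a+sign-b<support : sign (D a) + sign (D b) < sum (λ x → sign (D x))
    sign-a+sign-b<support = subst (sign (D a) + sign (D b) <_) (sym support)
      (s≤s (≤-trans (+-mono-≤ (sign≤1 (D a)) (sign≤1 (D b))) (m≤m+n 2 s)))

  module _ {ℓ k} (Dℓ≡1 : D ℓ ≡ 1) (k≢ℓ : k ≢ ℓ) (2≤Dk : 2 ≤ D k) where

    prune-isTreeSequence : IsTreeSequence s (prune ℓ k D)
    prune-isTreeSequence = record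
      { support = suc-injective (trans (sym (sum-update sign-agrees 1 sign-ℓ)) support)
      ; excess  = suc-injective (trans (sym (sum-update pred-agrees 1 pred-k)) excess)
      }
      where
      sign-agrees : ∀ x → x ≢ ℓ → sign (D x) ≡ sign (prune ℓ k D x)
      sign-agrees x x≢ℓ with x ≟ k
      ... | yes refl = trans (sign-pred 2≤Dk) (cong sign (sym (prune-k D x≢ℓ)))
        where
        sign-pred : ∀ {d} → 2 ≤ d → sign d ≡ sign (pred d)
        sign-pred (s≤s (s≤s _)) = refl
      ... | no x≢k   = cong sign (sym (prune-other D x≢ℓ x≢k))
      sign-ℓ : sign (D ℓ) ≡ 1 + sign (prune ℓ k D ℓ)
      sign-ℓ rewrite Dℓ≡1 | prune-ℓ {ℓ = ℓ} {k} D = refl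
      pred-agrees : ∀ x → x ≢ k → pred (D x) ≡ pred (prune ℓ k D x)
      pred-agrees x x≢k with x ≟ ℓ
      ... | yes refl rewrite Dℓ≡1 | prune-ℓ {ℓ = x} {k} D = refl
      ... | no x≢ℓ = cong pred (sym (prune-other D x≢ℓ x≢k))
      pred-k : pred (D k) ≡ 1 + pred (prune ℓ k D k)
      pred-k rewrite prune-k D k≢ℓ = pred-pred 2≤Dk
        where
        pred-pred : ∀ {d} → 2 ≤ d → pred d ≡ 1 + pred (pred d)
        pred-pred (s≤s (s≤s _)) = refl

    weight-prune : weight D ≡ pred (D k) * weight (prune ℓ k D)
    weight-prune = product-update factorial-agrees (pred (D k)) factorial-k
      where
      factorial-agrees : ∀ x → x ≢ k → pred (D x) ! ≡ pred (prune ℓ k D x) !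
      factorial-agrees x x≢k with x ≟ ℓ
      ... | yes refl rewrite Dℓ≡1 | prune-ℓ {ℓ = x} {k} D = refl
      ... | no x≢ℓ = cong (λ d → pred d !) (sym (prune-other D x≢ℓ x≢k))
      factorial-k : pred (D k) ! ≡ pred (D k) * pred (prune ℓ k D k) !
      factorial-k rewrite prune-k D k≢ℓ = pred-factorial 2≤Dk
        where
        pred-factorial : ∀ {d} → 2 ≤ d → pred d ! ≡ pred d * pred (pred d) !
        pred-factorial (s≤s (s≤s _)) = refl

two-leaves : ∀ {n} {D : Fin n → ℕ} → IsTreeSequence 0 D →
  Σ (Fin n) λ ℓ → Σ (Fin n) λ b → b ≢ ℓ × D ℓ ≡ 1 × D b ≡ 1 × (∀ c → c ≢ ℓ → c ≢ b → D c ≡ 0)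
two-leaves {D = D} seq with leaf-exists seq
... | ℓ , Dℓ≡1 with other-positive (λ x → sign (D x)) {ℓ}
                     (subst₂ _<_ (sym (cong sign Dℓ≡1)) (sym (IsTreeSequence.support seq)) ≤-refl)
...   | b , b≢ℓ , 1≤sign-b = ℓ , b , b≢ℓ , Dℓ≡1 , Db≡1 , others-0
  where
  open IsTreeSequence seq
  Db≡1 : D b ≡ 1
  Db≡1 = leaf (sum-zero⁻ _ excess b) 1≤sign-b
    where
    leaf : ∀ {d} → pred d ≡ 0 → 1 ≤ sign d → d ≡ 1
    leaf {suc zero} _ _ = refl
  others-0 : ∀ c → c ≢ ℓ → c ≢ b → D c ≡ 0
  others-0 c c≢ℓ c≢b = sign≡0 (zero-outside (λ x → sign (D x)) (b≢ℓ ∘′ sym) support′ c c≢ℓ c≢b)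
    where
    support′ : sum (λ x → sign (D x)) ≡ sign (D ℓ) + sign (D b)
    support′ = trans support (cong₂ (λ u v → sign u + sign v) (sym Dℓ≡1) (sym Db≡1))
    sign≡0 : ∀ {d} → sign d ≡ 0 → d ≡ 0
    sign≡0 {zero} _ = refl

-- Pruning at k lowers pred (D x) by one if k = x and leaves it unchanged otherwise.
sum-pred-prune : ∀ {n} {D : Fin n → ℕ} {ℓ x} → D ℓ ≡ 1 → x ≢ ℓ →
  sum (λ k → pred (D k) * pred (prune ℓ k D x)) + pred (D x) ≡ sum (λ k → pred (D k)) * pred (D x)
sum-pred-prune {D = D} {ℓ} {x} Dℓ≡1 x≢ℓ = begin
  sum (λ k → pred (D k) * pred (prune ℓ k D x)) + pred (D x)  ≡⟨ +-comm _ (pred (D x)) ⟩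
  pred (D x) + sum (λ k → pred (D k) * pred (prune ℓ k D x))  ≡⟨ sum-update agree (pred (D x)) at-x ⟨
  sum (λ k → pred (D k) * pred (D x))                         ≡⟨ *-distribʳ-sum (pred (D x)) (λ k → pred (D k)) ⟨
  sum (λ k → pred (D k)) * pred (D x)                         ∎
  where
  open ≡-Reasoning
  agree : ∀ k → k ≢ x → pred (D k) * pred (D x) ≡ pred (D k) * pred (prune ℓ k D x)
  agree k k≢x with k ≟ ℓ
  ... | yes refl rewrite Dℓ≡1 = refl
  ... | no k≢ℓ   = cong (λ d → pred (D k) * pred d) (sym (prune-other D x≢ℓ (k≢x ∘′ sym)))
  at-x : pred (D x) * pred (D x) ≡ pred (D x) + pred (D x) * pred (prune ℓ x D x)
  at-x rewrite prune-k {ℓ = ℓ} D x≢ℓ with pred (D x)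
  ... | zero  = refl
  ... | suc p = *-suc (suc p) p

sum-pred-prune-pair : ∀ {n s} {D : Fin n → ℕ} {ℓ i j} → sum (λ k → pred (D k)) ≡ 2 + s → D ℓ ≡ 1 → i ≢ ℓ → j ≢ ℓ →
  sum (λ k → pred (D k) * (pred (prune ℓ k D i) + pred (prune ℓ k D j))) ≡ suc s * (pred (D i) + pred (D j))
sum-pred-prune-pair {n} {s} {D} {ℓ} {i} {j} excess Dℓ≡1 i≢ℓ j≢ℓ = +-cancelʳ-≡ A _ _ (begin
  sum (λ k → pred (D k) * (pred (prune ℓ k D i) + pred (prune ℓ k D j))) + A
    ≡⟨ cong (_+ A) (trans (sum-cong-≗ (λ k → *-distribˡ-+ (pred (D k)) _ _)) (∑-distrib-+ Xᵢ Xⱼ)) ⟩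
  (sum Xᵢ + sum Xⱼ) + (pred (D i) + pred (D j))
    ≡⟨ +-interchange (sum Xᵢ) _ _ _ ⟩
  (sum Xᵢ + pred (D i)) + (sum Xⱼ + pred (D j))
    ≡⟨ cong₂ _+_ (sum-pred-prune {D = D} Dℓ≡1 i≢ℓ) (sum-pred-prune {D = D} Dℓ≡1 j≢ℓ) ⟩
  sum (λ k → pred (D k)) * pred (D i) + sum (λ k → pred (D k)) * pred (D j)
    ≡⟨ trans (sym (*-distribˡ-+ (sum (λ k → pred (D k))) (pred (D i)) (pred (D j)))) (cong (_* A) excess) ⟩
  (2 + s) * A
    ≡⟨ +-comm A (suc s * A) ⟩
  suc s * A + A ∎)
  where
  open ≡-Reasoning
  A : ℕ
  A = pred (D i) + pred (D j)
  Xᵢ Xⱼ : Fin n → ℕ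
  Xᵢ k = pred (D k) * pred (prune ℓ k D i)
  Xⱼ k = pred (D k) * pred (prune ℓ k D j)

treeDegSeq⇒isTreeSequence : ∀ m {D : Fin (2 + m) → ℕ} → TreeDegSeq (2 + m) D → IsTreeSequence m D
treeDegSeq⇒isTreeSequence m {D} (D-positive , ∑D) = record
  { support = trans (sum-cong-≗ (λ x → sign≡1 (D-positive x))) (sum-ones (2 + m))
  ; excess  = +-cancelˡ-≡ (2 + m) _ _ (begin
      2 + m + sum (λ x → pred (D x))                     ≡⟨ cong (_+ sum (λ x → pred (D x))) (sum-ones (2 + m)) ⟨
      sum {2 + m} (λ _ → 1) + sum (λ x → pred (D x))     ≡⟨ ∑-distrib-+ (λ _ → 1) (λ x → pred (D x)) ⟨
      sum (λ x → suc (pred (D x)))                        ≡⟨ sum-cong-≗ (λ x → suc-pred (D x) {{>-nonZero (D-positive x)}}) ⟩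
      sum D                                               ≡⟨ sum-cong-≗ (lookup∘tabulate D) ⟨
      sum (lookup (Vec.tabulate D))                       ≡⟨ sum-lookup (Vec.tabulate D) ⟨
      Vec.sum (Vec.tabulate D)                            ≡⟨ ∑D ⟩
      m + (2 + m + 0)                                     ≡⟨ trans (cong (m +_) (+-identityʳ (2 + m))) (+-comm m (2 + m)) ⟩
      2 + m + m                                           ∎)
  }
  where
  open ≡-Reasoning
  sign≡1 : ∀ {d} → 1 ≤ d → sign d ≡ 1
  sign≡1 {suc _} _ = refl

-- Enumerations of graphs

record Enumerates {n} (P : Graph n → Set) (L : List (Graph n)) : Set where
  field
    unique   : Unique L
    sound    : ∀ {G} → G ∈ L → P G
    complete : ∀ {G} → P G → G ∈ L

enumerates : ∀ {n} {P : Graph n → Set} {L} → Unique L → (∀ G → (G ∈ L) ⇔ P G) → Enumerates P L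
enumerates unique ∈⇔P = record
  { unique = unique ; sound = λ {G} → Equivalence.to (∈⇔P G) ; complete = λ {G} → Equivalence.from (∈⇔P G) }

enumerates-⇔ : ∀ {n} {P Q : Graph n → Set} {L} → Enumerates P L → (∀ {G} → P G → Q G) → (∀ {G} → Q G → P G) →
               Enumerates Q L
enumerates-⇔ E P⇒Q Q⇒P = record
  { unique = Enumerates.unique E ; sound = P⇒Q ∘′ Enumerates.sound E ; complete = Enumerates.complete E ∘′ Q⇒P }

module _ {A : Set} where

  length-∉ : ∀ (xs : List A) → (∀ {x} → x ∉ xs) → length xs ≡ 0
  length-∉ []       _    = refl
  length-∉ (x ∷ xs) none = ⊥-elim (none (here refl))

  length-≡1 : ∀ {xs : List A} {a} → Unique xs → a ∈ xs → (∀ {x} → x ∈ xs → x ≡ a) → length xs ≡ 1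
  length-≡1 {x ∷ []}     _                  _ _    = refl
  length-≡1 {x ∷ y ∷ xs} ((x≢y ∷ _) ∷ _) _ only-a =
    ⊥-elim (x≢y (trans (only-a (here refl)) (sym (only-a (there (here refl))))))

  unique-map : ∀ {B : Set} (f : A → B) {xs} → (∀ {x y} → x ∈ xs → y ∈ xs → f x ≡ f y → x ≡ y) → Unique xs → Unique (map f xs)
  unique-map f {[]}     _         []            = []
  unique-map f {x ∷ xs} injective (x∉ ∷ unique) =
    All.map⁺ (All.tabulate distinct) ∷ unique-map f (λ x∈ y∈ → injective (there x∈) (there y∈)) unique
    where
    distinct : ∀ {y} → y ∈ xs → f x ≢ f y
    distinct y∈ fx≡fy = All.lookup x∉ y∈ (injective (here refl) (there y∈) fx≡fy)

adjacent? : ∀ {n} (ℓ k : Fin n) (G : Graph n) → Dec (Adj G ℓ k)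
adjacent? ℓ k G = entry G ℓ k Bool.≟ true

length-filter-∷ : ∀ {n} (ℓ k : Fin n) G xs →
  length (filter (adjacent? ℓ k) (G ∷ xs)) ≡ indicator (entry G ℓ k) + length (filter (adjacent? ℓ k) xs)
length-filter-∷ ℓ k G xs with entry G ℓ k
... | true  = refl
... | false = refl

module _ {n} (ℓ : Fin n) where

  neighbours-of : Fin n → List (Graph n) → List (Graph n)
  neighbours-of k = filter (adjacent? ℓ k)

  length-by-neighbour : ∀ xs → (∀ {G} → G ∈ xs → deg G ℓ ≡ 1) → length xs ≡ sum (λ k → length (neighbours-of k xs))
  length-by-neighbour []       _      = sym (sum-zero (λ k → length (neighbours-of k [])) (λ _ → refl))
  length-by-neighbour (G ∷ xs) leaf-ℓ = sym (begin
    sum (λ k → length (neighbours-of k (G ∷ xs)))                        ≡⟨ sum-cong-≗ (λ k → length-filter-∷ ℓ k G xs) ⟩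
    sum (λ k → indicator (entry G ℓ k) + length (neighbours-of k xs))
      ≡⟨ ∑-distrib-+ (λ k → indicator (entry G ℓ k)) (λ k → length (neighbours-of k xs)) ⟩
    sum (λ k → indicator (entry G ℓ k)) + sum (λ k → length (neighbours-of k xs))
      ≡⟨ cong₂ _+_ (trans (sym (deg-sum G ℓ)) (leaf-ℓ (here refl))) (sym (length-by-neighbour xs (leaf-ℓ ∘′ there))) ⟩
    suc (length xs)                                                      ∎)
    where open ≡-Reasoning

  neighbours-of-enumerates : ∀ {P k L} → Enumerates P L → Enumerates (λ G → P G × Adj G ℓ k) (neighbours-of k L)
  neighbours-of-enumerates {k = k} {L} E = record
    { unique   = Unique.filter⁺ (adjacent? ℓ k) (Enumerates.unique E)
    ; sound    = λ G∈ → let G∈L , ℓk = ∈-filter⁻ (adjacent? ℓ k) {xs = L} G∈ in Enumerates.sound E G∈L , ℓk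
    ; complete = λ (PG , ℓk) → ∈-filter⁺ (adjacent? ℓ k) (Enumerates.complete E PG) ℓk
    }

module _ {n} {D : Fin n → ℕ} {ℓ k : Fin n} (Dℓ≡1 : D ℓ ≡ 1) (k≢ℓ : k ≢ ℓ) (2≤Dk : 2 ≤ D k)
         {Q : Graph n → Set} (Q-isolate : ∀ G → Q G → Q (isolate ℓ G)) (Q-addEdge : ∀ G → Q G → Q (addEdge ℓ k G))
         where

  isolate-enumerates : ∀ {X} → Enumerates (λ G → (TreeOn D G × Q G) × Adj G ℓ k) X →
                       Enumerates (λ G → TreeOn (prune ℓ k D) G × Q G) (map (isolate ℓ) X)
  isolate-enumerates {X} E = record
    { unique   = unique-map (isolate ℓ) injective (Enumerates.unique E)
    ; sound    = sound
    ; complete = complete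
    }
    where
    restore : ∀ {G} → G ∈ X → addEdge ℓ k (isolate ℓ G) ≡ G
    restore G∈ = let (T , _) , ℓk = Enumerates.sound E G∈
                 in addEdge-isolate (TreeOn.simple T) (trans (TreeOn.degrees T ℓ) Dℓ≡1) ℓk
    injective : ∀ {G H} → G ∈ X → H ∈ X → isolate ℓ G ≡ isolate ℓ H → G ≡ H
    injective G∈ H∈ eq = trans (sym (restore G∈)) (trans (cong (addEdge ℓ k) eq) (restore H∈))
    sound : ∀ {G} → G ∈ map (isolate ℓ) X → TreeOn (prune ℓ k D) G × Q G
    sound G∈ with ∈-map⁻ (isolate ℓ) G∈
    ... | H , H∈ , refl = let (T , q) , ℓk = Enumerates.sound E H∈ in isolate-leaf T Dℓ≡1 ℓk , Q-isolate H q
    complete : ∀ {G} → TreeOn (prune ℓ k D) G × Q G → G ∈ map (isolate ℓ) X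
    complete {G} (T , q) = subst (_∈ map (isolate ℓ) X)
      (isolate-addEdge (TreeOn.simple T) (trans (TreeOn.degrees T ℓ) (prune-ℓ D)))
      (∈-map⁺ (isolate ℓ) (Enumerates.complete E ((T′ , Q-addEdge G q) , addEdge-ℓk ℓ k G)))
      where
      T′ : TreeOn D (addEdge ℓ k G)
      T′ = addEdge-leaf (k≢ℓ ∘′ sym) Dℓ≡1 (≤-trans (s≤s z≤n) 2≤Dk) T (inj₁ (suc[m]≤n⇒m≤pred[n] 2≤Dk))

-- Counting trees

WeightedCount : ∀ {n} → (Graph n → Set) → (Fin n → ℕ) → ℕ → Set
WeightedCount Q D c = ∀ {L} → Enumerates (λ G → TreeOn D G × Q G) L → length L * weight D ≡ c

count-single-edge : ∀ {n} {D : Fin n → ℕ} → IsTreeSequence 0 D → WeightedCount (λ _ → ⊤) D 1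
count-single-edge {n} {D} seq {L} E with two-leaves seq
... | ℓ , b , b≢ℓ , Dℓ≡1 , Db≡1 , others-0 =
  cong₂ _*_ (length-≡1 (Enumerates.unique E) single-edge∈ all-single-edge) weight≡1
  where
  pred≡0 : ∀ x → pred (D x) ≡ 0
  pred≡0 = sum-zero⁻ _ (IsTreeSequence.excess seq)
  weight≡1 : weight D ≡ 1
  weight≡1 = trans (product-cong-≗ (λ x → cong _! (pred≡0 x))) (product-ones n)
  pruned-0 : ∀ x → prune ℓ b D x ≡ 0
  pruned-0 x with x ≟ ℓ | x ≟ b
  ... | yes refl | _        = prune-ℓ D
  ... | no x≢ℓ   | yes refl = trans (prune-k D x≢ℓ) (pred≡0 x)
  ... | no x≢ℓ   | no x≢b   = trans (prune-other D x≢ℓ x≢b) (others-0 x x≢ℓ x≢b)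
  single-edge∈ : addEdge ℓ b emptyGraph ∈ L
  single-edge∈ = Enumerates.complete E
    (addEdge-leaf (b≢ℓ ∘′ sym) Dℓ≡1 (≤-reflexive (sym Db≡1)) (emptyGraph-tree pruned-0) (inj₂ others-0) , tt)
  all-single-edge : ∀ {G} → G ∈ L → G ≡ addEdge ℓ b emptyGraph
  all-single-edge {G} G∈ = trans (sym (addEdge-isolate S deg-ℓ≡1 ℓb)) (cong (addEdge ℓ b) isolated-empty)
    where
    T : TreeOn D G
    T = proj₁ (Enumerates.sound E G∈)
    open TreeOn T using (degrees) renaming (simple to S)
    deg-ℓ≡1 : deg G ℓ ≡ 1
    deg-ℓ≡1 = trans (degrees ℓ) Dℓ≡1
    ℓb : Adj G ℓ b
    ℓb with neighbour G (≤-reflexive (sym deg-ℓ≡1))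
    ... | k , ℓk with k ≟ b
    ...   | yes refl = ℓk
    ...   | no k≢b   = ⊥-elim (<⇒≱ (subst (1 ≤_) (degrees k) (adj⇒1≤deg G (adj-sym S ℓk)))
                                   (≤-reflexive (others-0 k (adj⇒≢ S ℓk ∘′ sym) k≢b)))
    isolated-empty : isolate ℓ G ≡ emptyGraph
    isolated-empty = degrees-zero⇒empty pruned-0 (isolate ℓ G) (TreeOn.degrees (isolate-leaf T Dℓ≡1 ℓb))

module _ {n s} {D : Fin n → ℕ} (seq : IsTreeSequence (suc s) D) {ℓ} (Dℓ≡1 : D ℓ ≡ 1)
         {Q : Graph n → Set} (Q-isolate : ∀ G → Q G → Q (isolate ℓ G))
         (Q-addEdge : ∀ k G → Q G → Q (addEdge ℓ k G))
         where

  count-with-leaf-edge : ∀ {k} c → (k ≢ ℓ → 2 ≤ D k → WeightedCount Q (prune ℓ k D) c) →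
    ∀ {F} → Enumerates (λ G → (TreeOn D G × Q G) × Adj G ℓ k) F → length F * weight D ≡ pred (D k) * c
  count-with-leaf-edge {k} c count-pruned {F} E with 2 ≤? D k
  ... | no 2≰Dk = trans (cong (_* weight D) (length-∉ F no-member)) (sym (cong (_* c) (≱2⇒pred≡0 2≰Dk)))
    where
    no-member : ∀ {G} → G ∉ F
    no-member G∈ = let (T , _) , ℓk = Enumerates.sound E G∈
      in 2≰Dk (leaf-neighbour-2≤deg T Dℓ≡1 ℓk (third-vertex seq (adj⇒≢ (TreeOn.simple T) ℓk)))
    ≱2⇒pred≡0 : ∀ {d} → ¬ 2 ≤ d → pred d ≡ 0
    ≱2⇒pred≡0 {zero}        _   = refl
    ≱2⇒pred≡0 {suc zero}    _   = refl
    ≱2⇒pred≡0 {suc (suc _)} 2≰ = ⊥-elim (2≰ (s≤s (s≤s z≤n)))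
  ... | yes 2≤Dk = begin
    length F * weight D                      ≡⟨ cong (length F *_) (weight-prune seq Dℓ≡1 k≢ℓ 2≤Dk) ⟩
    length F * (pred (D k) * weight D′)      ≡⟨ x∙yz≈y∙xz (length F) (pred (D k)) (weight D′) ⟩
    pred (D k) * (length F * weight D′)      ≡⟨ cong (λ m → pred (D k) * (m * weight D′)) (length-map (isolate ℓ) F) ⟨
    pred (D k) * (length F′ * weight D′)     ≡⟨ cong (pred (D k) *_) (count-pruned k≢ℓ 2≤Dk pruned) ⟩
    pred (D k) * c                           ∎
    where
    open ≡-Reasoning
    D′ : Fin n → ℕ
    D′ = prune ℓ k D
    F′ : List (Graph n)
    F′ = map (isolate ℓ) F
    k≢ℓ : k ≢ ℓ
    k≢ℓ refl = <⇒≱ 2≤Dk (≤-reflexive Dℓ≡1)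
    pruned : Enumerates (λ G → TreeOn D′ G × Q G) F′
    pruned = isolate-enumerates Dℓ≡1 k≢ℓ 2≤Dk Q-isolate (Q-addEdge k) E

  count-by-leaf-neighbour : ∀ (c : Fin n → ℕ) → (∀ k → k ≢ ℓ → 2 ≤ D k → WeightedCount Q (prune ℓ k D) (c k)) →
                            WeightedCount Q D (sum (λ k → pred (D k) * c k))
  count-by-leaf-neighbour c count-pruned {L} E = begin
    length L * weight D                  ≡⟨ cong (_* weight D) (length-by-neighbour ℓ L leaf-ℓ) ⟩
    sum (λ k → length (F k)) * weight D  ≡⟨ *-distribʳ-sum (weight D) (λ k → length (F k)) ⟩
    sum (λ k → length (F k) * weight D)
      ≡⟨ sum-cong-≗ (λ k → count-with-leaf-edge (c k) (count-pruned k) (F-enumerates k)) ⟩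
    sum (λ k → pred (D k) * c k)         ∎
    where
    open ≡-Reasoning
    F : Fin n → List (Graph n)
    F k = neighbours-of ℓ k L
    F-enumerates : ∀ k → Enumerates (λ G → (TreeOn D G × Q G) × Adj G ℓ k) (F k)
    F-enumerates k = neighbours-of-enumerates ℓ E
    leaf-ℓ : ∀ {G} → G ∈ L → deg G ℓ ≡ 1
    leaf-ℓ G∈ = trans (TreeOn.degrees (proj₁ (Enumerates.sound E G∈)) ℓ) Dℓ≡1

treeCount : ∀ s {n} {D : Fin n → ℕ} → IsTreeSequence s D → WeightedCount (λ _ → ⊤) D (s !)
treeCount zero    seq = count-single-edge seq
treeCount (suc s) {D = D} seq {L} E with leaf-exists seq
... | ℓ , Dℓ≡1 = begin
  length L * weight D
    ≡⟨ count-by-leaf-neighbour seq Dℓ≡1 (λ _ _ → tt) (λ _ _ _ → tt) (λ _ → s !) count-pruned E ⟩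
  sum (λ k → pred (D k) * s !)  ≡⟨ *-distribʳ-sum (s !) (λ k → pred (D k)) ⟨
  sum (λ k → pred (D k)) * s !  ≡⟨ cong (_* s !) (IsTreeSequence.excess seq) ⟩
  suc s * s !                   ∎
  where
  open ≡-Reasoning
  count-pruned : ∀ k → k ≢ ℓ → 2 ≤ D k → WeightedCount (λ _ → ⊤) (prune ℓ k D) (s !)
  count-pruned k k≢ℓ 2≤Dk = treeCount s (prune-isTreeSequence seq Dℓ≡1 k≢ℓ 2≤Dk)

edgeCount-leaf : ∀ s {n} {D : Fin n → ℕ} {i j} → IsTreeSequence (suc s) D → D i ≡ 1 →
                 WeightedCount (λ G → Adj G i j) D ((pred (D i) + pred (D j)) * s !)
edgeCount-leaf s {D = D} {i} {j} seq Di≡1 E rewrite Di≡1 =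
  count-with-leaf-edge seq Di≡1 (λ _ _ → tt) (λ _ _ _ → tt) (s !) count-pruned
    (enumerates-⇔ E (λ (T , ij) → (T , tt) , ij) (λ ((T , _) , ij) → T , ij))
  where
  count-pruned : j ≢ i → 2 ≤ D j → WeightedCount (λ _ → ⊤) (prune i j D) (s !)
  count-pruned j≢i 2≤Dj = treeCount s (prune-isTreeSequence seq Di≡1 j≢i 2≤Dj)

edgeCount : ∀ s {n} {D : Fin n → ℕ} {i j} → IsTreeSequence (suc s) D → i ≢ j → 1 ≤ D i → 1 ≤ D j →
            WeightedCount (λ G → Adj G i j) D ((pred (D i) + pred (D j)) * s !)

edgeCount-inner : ∀ s {n} {D : Fin n → ℕ} {i j} → IsTreeSequence (suc s) D → i ≢ j → 2 ≤ D i → 2 ≤ D j →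
                  WeightedCount (λ G → Adj G i j) D ((pred (D i) + pred (D j)) * s !)
edgeCount-inner zero {D = D} {i} {j} seq i≢j 2≤Di 2≤Dj E = ⊥-elim (<⇒≱ 2≤excess excess≤1)
  where
  2≤excess : 2 ≤ pred (D i) + pred (D j)
  2≤excess = +-mono-≤ (suc[m]≤n⇒m≤pred[n] 2≤Di) (suc[m]≤n⇒m≤pred[n] 2≤Dj)
  excess≤1 : pred (D i) + pred (D j) ≤ 1
  excess≤1 = subst (pred (D i) + pred (D j) ≤_) (IsTreeSequence.excess seq) (pair≤sum (λ x → pred (D x)) i≢j)
edgeCount-inner (suc s) {n} {D} {i} {j} seq i≢j 2≤Di 2≤Dj {L} E with leaf-exists seq
... | ℓ , Dℓ≡1 = begin
  length L * weight D
    ≡⟨ count-by-leaf-neighbour seq Dℓ≡1 Q-isolate Q-addEdge (λ k → A k * s !) count-pruned E ⟩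
  sum (λ k → pred (D k) * (A k * s !)) ≡⟨ sum-cong-≗ (λ k → *-assoc (pred (D k)) (A k) (s !)) ⟨
  sum (λ k → pred (D k) * A k * s !)   ≡⟨ *-distribʳ-sum (s !) (λ k → pred (D k) * A k) ⟨
  sum (λ k → pred (D k) * A k) * s !
    ≡⟨ cong (_* s !) (sum-pred-prune-pair {D = D} (IsTreeSequence.excess seq) Dℓ≡1 i≢ℓ j≢ℓ) ⟩
  suc s * Aᵢⱼ * s !                    ≡⟨ *-assoc (suc s) Aᵢⱼ (s !) ⟩
  suc s * (Aᵢⱼ * s !)                  ≡⟨ x∙yz≈y∙xz (suc s) Aᵢⱼ (s !) ⟩
  Aᵢⱼ * suc s !                        ∎
  where
  open ≡-Reasoning
  Aᵢⱼ : ℕ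
  Aᵢⱼ = pred (D i) + pred (D j)
  A : Fin n → ℕ
  A k = pred (prune ℓ k D i) + pred (prune ℓ k D j)
  non-leaf : ∀ {x} → 2 ≤ D x → x ≢ ℓ
  non-leaf 2≤Dx refl = <⇒≱ 2≤Dx (≤-reflexive Dℓ≡1)
  i≢ℓ : i ≢ ℓ
  i≢ℓ = non-leaf 2≤Di
  j≢ℓ : j ≢ ℓ
  j≢ℓ = non-leaf 2≤Dj
  Q-isolate : ∀ G → Adj G i j → Adj (isolate ℓ G) i j
  Q-isolate G = trans (isolate-elsewhere ℓ G i≢ℓ j≢ℓ)
  Q-addEdge : ∀ k G → Adj G i j → Adj (addEdge ℓ k G) i j
  Q-addEdge k G = addEdge-⊇ ℓ k G
  count-pruned : ∀ k → k ≢ ℓ → 2 ≤ D k → WeightedCount (λ G → Adj G i j) (prune ℓ k D) (A k * s !)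
  count-pruned k k≢ℓ 2≤Dk = edgeCount s (prune-isTreeSequence seq Dℓ≡1 k≢ℓ 2≤Dk) i≢j
    (prune-positive D i≢ℓ 2≤Di) (prune-positive D j≢ℓ 2≤Dj)

edgeCount s {D = D} {i} {j} seq i≢j 1≤Di 1≤Dj E with D i ≟ℕ 1 | D j ≟ℕ 1
... | yes Di≡1 | _        = edgeCount-leaf s seq Di≡1 E
... | no _     | yes Dj≡1 = trans (edgeCount-leaf s seq Dj≡1 (enumerates-⇔ E swap swap))
                                  (cong (_* s !) (+-comm (pred (D j)) (pred (D i))))
  where
  swap : ∀ {G a b} → TreeOn D G × Adj G a b → TreeOn D G × Adj G b a
  swap (T , ab) = T , adj-sym (TreeOn.simple T) ab
... | no Di≢1  | no Dj≢1  = edgeCount-inner s seq i≢j (≥1∧≢1⇒≥2 1≤Di Di≢1) (≥1∧≢1⇒≥2 1≤Dj Dj≢1) E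
  where
  ≥1∧≢1⇒≥2 : ∀ {d} → 1 ≤ d → d ≢ 1 → 2 ≤ d
  ≥1∧≢1⇒≥2 {suc zero}    _ d≢1 = ⊥-elim (d≢1 refl)
  ≥1∧≢1⇒≥2 {suc (suc _)} _ _   = s≤s (s≤s z≤n)

mainTheorem3 : (n : ℕ) → 3 ≤ n → (D : Fin n → ℕ) → TreeDegSeq n D →
    (i j : Fin n) → i ≢ j →
    (L L' : List (Graph n)) →
    Unique L → (∀ G → (G ∈ L) ⇔ (IsTree G × HasDegrees G D)) →
    Unique L' → (∀ G → (G ∈ L') ⇔ (IsTree G × HasDegrees G D × Adj G i j)) →
    length L' * (n ∸ 2) ≡ (D i + D j ∸ 2) * length L
mainTheorem3 (suc (suc (suc t))) (s≤s (s≤s (s≤s _))) D D-tree@(D-positive , _) i j i≢j L L' uL ∈L⇔ uL' ∈L'⇔ =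
  *-cancelʳ-≡ _ _ (weight D) {{>-nonZero (1≤weight D)}} (begin
    length L' * suc t * weight D    ≡⟨ xy∙z≈y∙xz (length L') (suc t) (weight D) ⟩
    suc t * (length L' * weight D)  ≡⟨ cong (suc t *_) edges ⟩
    suc t * (A * t !)               ≡⟨ x∙yz≈y∙xz (suc t) A (t !) ⟩
    A * suc t !                     ≡⟨ cong (A *_) trees ⟨
    A * (length L * weight D)       ≡⟨ *-assoc A (length L) (weight D) ⟨
    A * length L * weight D         ∎)
  where
  open ≡-Reasoning
  A : ℕ
  A = D i + D j ∸ 2
  seq : IsTreeSequence (suc t) D
  seq = treeDegSeq⇒isTreeSequence (suc t) D-tree
  trees : length L * weight D ≡ suc t !
  trees = treeCount (suc t) seq (enumerates-⇔ (enumerates uL ∈L⇔)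
    (λ G-tree → isTree⇒treeOn G-tree , tt) (treeOn⇒isTree D-positive ∘′ proj₁))
  A≡ : A ≡ pred (D i) + pred (D j)
  A≡ with D i | D j | D-positive i | D-positive j
  ... | suc a | suc b | _ | _ = cong (_∸ 1) (+-suc a b)
  edges : length L' * weight D ≡ A * t !
  edges = trans (edgeCount t seq i≢j (D-positive i) (D-positive j) (enumerates-⇔ (enumerates uL' ∈L'⇔)
      (λ (T , H , ij) → isTree⇒treeOn (T , H) , ij)
      (λ (T , ij) → let T′ , H = treeOn⇒isTree D-positive T in T′ , H , ij)))
    (cong (_* t !) (sym A≡))
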